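{- Let $k\ge2$ be such that $T_k(x)=x^k+x+1$ is primitive over $\mathbb{F}_2$, and let $M_k$ be the binary cyclic word defined below. Then the circular Burrows--Wheeler transform of $M_k$ is \[\operatorname{cBWT}(M_k)=1\,(0011)^{2^{k-2}-1}\,010.\]
   Context: Binary alphabet $\{0,1\}$ with $0<1$; $\oplus$ is addition mod 2. Define $F':\{0,1\}^k\to\{0,1\}^k$ by $F'(x_0,\dots,x_{k-1})=(x_1,\dots,x_{k-1},\,x_0\oplus x_1\oplus\delta(x))$, where $\delta(x)=1$ if $x\in\{0^k,\,10^{k-1}\}$ and $\delta(x)=0$ otherwise (this is the LFSR with recurrence $s_{t+k}=s_{t+1}\oplus s_t$ after cycle-joining the all-zero cycle via the conjugate pair $(0^k,10^{k-1})$; for primitive $T_k$ it is a single cycle through all $2^k$ states). Let $y_0=0^k$, $y_{t+1}=F'(y_t)$, let $s_t$ be the first coordinate of $y_t$, and let $D_k$ be the cyclic word $s_0s_1\cdots s_{2^k-1}$ (a binary de Bruijn sequence of order $k$). $M_k$ is the cyclic word obtained from $D_k$ by reversing it and then complementing every bit. For a cyclic word $w$ of length $n$, $\operatorname{cBWT}(w)$ is the last column of the $n\times n$ matrix whose rows are the $n$ cyclic rotations of $w$ sorted lexicographically (independent of the chosen rotation). -}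

module Defs where

open import Data.Bool using (Bool; true; false; not; _xor_; if_then_else_; _∨_)
open import Data.Bool.Properties as BoolP using ()
open import Data.Nat using (ℕ; zero; suc; _∸_; _^_; _<_)
open import Data.List using (List; []; _∷_; _++_; replicate; map; reverse; drop; take; upTo; length; last; concat)
open import Data.List.Properties using (≡-dec)
open import Data.Maybe using (fromMaybe)
open import Relation.Nullary using (Dec)
open import Data.Product using (Σ; ∃; _×_)
open import Data.Sum using (_⊎_)
open import Relation.Nullary using (¬_)
open import Relation.Nullary.Decidable using (⌊_⌋)
open import Relation.Binary.PropositionalEquality using (_≡_)
import Data.List.Relation.Binary.Lex.NonStrict as LexNS
import Data.List.Sort.MergeSort as Sort

-- Polynomials over F₂ : coefficient lists (lowest degree first),
-- compared coefficientwise (so trailing zeros are irrelevant).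

Poly : Set
Poly = List Bool

coeff : Poly → ℕ → Bool
coeff []      _       = false
coeff (a ∷ p) zero    = a
coeff (a ∷ p) (suc i) = coeff p i

_≈ₚ_ : Poly → Poly → Set
p ≈ₚ q = ∀ i → coeff p i ≡ coeff q i

infixl 6 _+ₚ_
infixl 7 _*ₚ_

_+ₚ_ : Poly → Poly → Poly
[]      +ₚ q       = q
(a ∷ p) +ₚ []      = a ∷ p
(a ∷ p) +ₚ (b ∷ q) = (a xor b) ∷ (p +ₚ q)

_*ₚ_ : Poly → Poly → Poly
[]      *ₚ q = []
(a ∷ p) *ₚ q = (if a then q else []) +ₚ (false ∷ (p *ₚ q))

oneₚ : Poly
oneₚ = true ∷ []

Xpow : ℕ → Poly
Xpow n = replicate n false ++ (true ∷ [])

_∣ₚ_ : Poly → Poly → Set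
g ∣ₚ f = ∃ λ q → (q *ₚ g) ≈ₚ f

-- irreducible: every factorisation has a unit factor (the only unit of F₂[x] is 1);
-- f must also be non-constant (not ≈ 0 and not ≈ 1 -- i.e. not a unit and nonzero)
Irreducible : Poly → Set
Irreducible f = ¬ (f ≈ₚ []) × ¬ (f ≈ₚ oneₚ) ×
  (∀ a b → (a *ₚ b) ≈ₚ f → (a ≈ₚ oneₚ) ⊎ (b ≈ₚ oneₚ))

-- a polynomial f of degree k over F₂ is primitive iff it is irreducible and
-- the order of x modulo f is 2^k − 1 (i.e. a root of f generates F_{2^k}^*)
Primitive : ℕ → Poly → Set
Primitive k f = Irreducible f ×
  (f ∣ₚ (Xpow (2 ^ k ∸ 1) +ₚ oneₚ)) ×
  (∀ n → 0 < n → n < 2 ^ k ∸ 1 → ¬ (f ∣ₚ (Xpow n +ₚ oneₚ)))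

T : ℕ → Poly
T k = Xpow k +ₚ Xpow 1 +ₚ oneₚ

δ : List Bool → Bool
δ x = ⌊ ≡-dec BoolP._≟_ x (replicate (length x) false) ⌋
    ∨ ⌊ ≡-dec BoolP._≟_ x (true ∷ replicate (length x ∸ 1) false) ⌋

-- F'(x₀,…,x_{k-1}) = (x₁,…,x_{k-1}, x₀ ⊕ x₁ ⊕ δ(x))  (only meaningful for k ≥ 2;
-- on shorter lists it is the identity, which is never used)
F' : List Bool → List Bool
F' (x₀ ∷ x₁ ∷ rest) = x₁ ∷ (rest ++ ((x₀ xor x₁) xor δ (x₀ ∷ x₁ ∷ rest)) ∷ [])
F' x = x

iter : ℕ → List Bool → List Bool
iter zero    y = y
iter (suc t) y = F' (iter t y)

y : ℕ → ℕ → List Bool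
y k t = iter t (replicate k false)

headOr0 : List Bool → Bool
headOr0 []      = false
headOr0 (a ∷ _) = a

s : ℕ → ℕ → Bool
s k t = headOr0 (y k t)

D : ℕ → List Bool
D k = map (s k) (upTo (2 ^ k))

M : ℕ → List Bool
M k = map not (reverse (D k))

lexOrder = LexNS.≤-decTotalOrder BoolP.≤-decTotalOrder

open Sort lexOrder using (sort)

rotate : ℕ → List Bool → List Bool
rotate i w = drop i w ++ take i w

rotations : List Bool → List (List Bool)
rotations w = map (λ i → rotate i w) (upTo (length w))

cBWT : List Bool → List Bool
cBWT w = map (λ r → fromMaybe false (last r)) (sort (rotations w))

target : ℕ → List Bool
target k = true ∷ (concat (replicate (2 ^ (k ∸ 2) ∸ 1) (false ∷ false ∷ true ∷ true ∷ []))
                   ++ (false ∷ true ∷ false ∷ []))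

module Submission where

-- The plain LFSR s_{t+k} = s_{t+1} ⊕ s_t steps through the residues of x^t modulo T_k, so by
-- primitivity its orbit from 0ᵏ⁻¹1 cannot return before 2^k − 1 steps, and a pigeonhole argument on the
-- nonzero states shows that it returns then. Cycle-joining inserts 0ᵏ into this cycle, so the
-- length-k windows of D_k, and hence of M_k, are all 2^k words, each once. The rotations of M_k therefore
-- sort by the values of their length-k prefixes: the row of rank j has prefix value j, and its last letter
-- is the complemented feedback bit of the state it encodes, which depends only on j mod 4 and on whether
-- j ≥ 2^k − 2.

open import Defs
open import Data.Bool using (Bool; true; false; not; _xor_; if_then_else_; _∨_; _∧_; f≤t; b≤b)
import Data.Bool.Properties as Boolₚ
open import Data.Empty using (⊥; ⊥-elim)
open import Data.List
  using (List; []; _∷_; _++_; _∷ʳ_; replicate; map; reverse; take; drop; length; applyUpTo; applyDownFrom; upTo; last; concat)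
open import Data.List.Properties
open import Data.List.Relation.Unary.All using (All; []; _∷_; universal)
import Data.List.Relation.Unary.All.Properties as Allₚ
open import Data.List.Relation.Unary.AllPairs using (AllPairs; []; _∷_)
import Data.List.Relation.Unary.AllPairs.Properties as AllPairsₚ
open import Data.List.Relation.Binary.Permutation.Propositional using (↭-sym; ↭⇒↭ₛ)
open import Data.List.Relation.Binary.Permutation.Propositional.Properties using (All-resp-↭; ↭-length)
import Data.List.Relation.Binary.Permutation.Setoid.Properties as Permₛ
open import Data.List.Sort.MergeSort lexOrder using (sort)
open import Data.List.Sort.MergeSort.Properties lexOrder using (sort-↭; sort-↗)
open import Data.List.Relation.Unary.Linked using (Linked; []; [-]; _∷_)
open import Data.List.Relation.Unary.Linked.Properties using (Linked⇒All)
open import Data.List.Relation.Binary.Lex.Core using (this; next)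
open import Data.Maybe using (just; fromMaybe)
open import Data.Maybe.Properties using (just-injective)
open import Data.Fin using (Fin; toℕ; fromℕ<)
open import Data.Fin.Properties using (pigeonhole; toℕ-fromℕ<; toℕ<n)
open import Data.Nat
  using (ℕ; zero; suc; _+_; _*_; _∸_; _^_; _≤_; _<_; z≤n; s≤s; z<s; s<s; ⌊_/2⌋; NonZero; _/_; _%_)
open import Data.Nat.DivMod using (m≡m%n+[m/n]*n; m%n<n)
open import Data.Nat.Properties
open import Data.Nat.Tactic.RingSolver using (solve-∀)
open import Data.Product using (_×_; _,_; proj₂; ∃)
open import Data.Sum using (inj₁; inj₂)
open import Function using (_∘_; _⇔_; mk⇔)
open import Relation.Binary.Bundles using (DecTotalOrder)
open import Relation.Binary.Definitions using (tri<; tri≈; tri>)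
open import Relation.Binary.PropositionalEquality
open import Relation.Nullary using (yes; no; does)
open import Relation.Nullary.Decidable using (dec-true; dec-false; does-⇔; isYes≗does)

replicate-∷ʳ : ∀ {A : Set} n (a : A) → replicate n a ∷ʳ a ≡ a ∷ replicate n a
replicate-∷ʳ zero    a = refl
replicate-∷ʳ (suc n) a = cong (a ∷_) (replicate-∷ʳ n a)

reverse-replicate : ∀ {A : Set} n (a : A) → reverse (replicate n a) ≡ replicate n a
reverse-replicate zero    a = refl
reverse-replicate (suc n) a = begin
  reverse (a ∷ replicate n a)   ≡⟨ unfold-reverse a (replicate n a) ⟩
  reverse (replicate n a) ∷ʳ a  ≡⟨ cong (_∷ʳ a) (reverse-replicate n a) ⟩
  replicate n a ∷ʳ a            ≡⟨ replicate-∷ʳ n a ⟩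
  a ∷ replicate n a             ∎
  where open ≡-Reasoning

take-++ˡ : ∀ {A : Set} (xs ys : List A) {j} → j ≤ length xs → take j (xs ++ ys) ≡ take j xs
take-++ˡ xs       ys {zero}  _         = refl
take-++ˡ (x ∷ xs) ys {suc j} (s≤s j≤) = cong (x ∷_) (take-++ˡ xs ys j≤)

length-take-≤ : ∀ {A : Set} {n} {xs : List A} → n ≤ length xs → length (take n xs) ≡ n
length-take-≤ {n = n} {xs} n≤ = trans (length-take n xs) (m≤n⇒m⊓n≡m n≤)

last-∷ʳ : ∀ {A : Set} (xs : List A) x → last (xs ∷ʳ x) ≡ just x
last-∷ʳ []           x = refl
last-∷ʳ (y ∷ [])     x = refl
last-∷ʳ (y ∷ z ∷ xs) x = last-∷ʳ (z ∷ xs) x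

infixl 9 _!_

_!_ : List Bool → ℕ → Bool
[]      ! _     = false
(b ∷ w) ! zero  = b
(b ∷ w) ! suc j = w ! j

∷ʳ-!-< : ∀ w c {j} → j < length w → (w ∷ʳ c) ! j ≡ w ! j
∷ʳ-!-< (b ∷ w) c {zero}  _         = refl
∷ʳ-!-< (b ∷ w) c {suc j} (s≤s j<) = ∷ʳ-!-< w c j<

∷ʳ-!-length : ∀ w c → (w ∷ʳ c) ! length w ≡ c
∷ʳ-!-length []      c = refl
∷ʳ-!-length (b ∷ w) c = ∷ʳ-!-length w c

replicate-false-! : ∀ n j → replicate n false ! j ≡ false
replicate-false-! zero    j       = refl
replicate-false-! (suc n) zero    = refl
replicate-false-! (suc n) (suc j) = replicate-false-! n j

module _ {A : Set} where

  applyUpTo-cong : ∀ {f g : ℕ → A} n → (∀ {i} → i < n → f i ≡ g i) → applyUpTo f n ≡ applyUpTo g n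
  applyUpTo-cong zero    _   = refl
  applyUpTo-cong (suc n) f≡g = cong₂ _∷_ (f≡g z<s) (applyUpTo-cong n (f≡g ∘ s<s))

  applyUpTo-+ : ∀ (f : ℕ → A) m n → applyUpTo f (m + n) ≡ applyUpTo f m ++ applyUpTo (f ∘ (m +_)) n
  applyUpTo-+ f zero    n = refl
  applyUpTo-+ f (suc m) n = cong (f 0 ∷_) (applyUpTo-+ (f ∘ suc) m n)

  take-applyUpTo : ∀ (f : ℕ → A) {m n} → m ≤ n → take m (applyUpTo f n) ≡ applyUpTo f m
  take-applyUpTo f z≤n       = refl
  take-applyUpTo f (s≤s m≤n) = cong (f 0 ∷_) (take-applyUpTo (f ∘ suc) m≤n)

  drop-applyUpTo : ∀ (f : ℕ → A) m n → drop m (applyUpTo f n) ≡ applyUpTo (f ∘ (m +_)) (n ∸ m)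
  drop-applyUpTo f zero    n       = refl
  drop-applyUpTo f (suc m) zero    = refl
  drop-applyUpTo f (suc m) (suc n) = drop-applyUpTo (f ∘ suc) m n

  applyDownFrom-applyUpTo : ∀ (f : ℕ → A) n → applyDownFrom f n ≡ applyUpTo (λ j → f (n ∸ suc j)) n
  applyDownFrom-applyUpTo f zero    = refl
  applyDownFrom-applyUpTo f (suc n) = cong (f n ∷_) (applyDownFrom-applyUpTo f n)

  last-applyUpTo : ∀ (f : ℕ → A) n → last (applyUpTo f (suc n)) ≡ just (f n)
  last-applyUpTo f zero    = refl
  last-applyUpTo f (suc n) = last-applyUpTo (f ∘ suc) n

rotate-applyUpTo : ∀ (f : ℕ → Bool) {i n} → i ≤ n → (∀ {j} → j < i → f (n + j) ≡ f j) →
                   rotate i (applyUpTo f n) ≡ applyUpTo (f ∘ (i +_)) n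
rotate-applyUpTo f {i} {n} i≤n periodic = begin
  drop i (applyUpTo f n) ++ take i (applyUpTo f n)
    ≡⟨ cong₂ _++_ (drop-applyUpTo f i n) (take-applyUpTo f i≤n) ⟩
  applyUpTo (f ∘ (i +_)) (n ∸ i) ++ applyUpTo f i
    ≡⟨ cong (applyUpTo (f ∘ (i +_)) (n ∸ i) ++_) (applyUpTo-cong i wrap) ⟩
  applyUpTo (f ∘ (i +_)) (n ∸ i) ++ applyUpTo (f ∘ (i +_) ∘ (n ∸ i +_)) i
    ≡⟨ applyUpTo-+ (f ∘ (i +_)) (n ∸ i) i ⟨
  applyUpTo (f ∘ (i +_)) (n ∸ i + i)
    ≡⟨ cong (applyUpTo (f ∘ (i +_))) (m∸n+n≡m i≤n) ⟩
  applyUpTo (f ∘ (i +_)) n ∎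
  where
    open ≡-Reasoning
    wrap : ∀ {j} → j < i → f j ≡ f (i + (n ∸ i + j))
    wrap {j} j<i = begin
      f j                 ≡⟨ periodic j<i ⟨
      f (n + j)           ≡⟨ cong (λ p → f (p + j)) (m+[n∸m]≡n i≤n) ⟨
      f (i + (n ∸ i) + j) ≡⟨ cong f (+-assoc i (n ∸ i) j) ⟩
      f (i + (n ∸ i + j)) ∎

n<2^n : ∀ n → n < 2 ^ n
n<2^n zero    = z<s
n<2^n (suc n) = begin
  suc (suc n)             ≤⟨ s≤s (n<2^n n) ⟩
  suc (2 ^ n)             ≡⟨ +-comm 1 (2 ^ n) ⟩
  2 ^ n + 1               ≤⟨ +-monoʳ-≤ (2 ^ n) (≤-trans (m^n>0 2 n) (m≤m+n (2 ^ n) 0)) ⟩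
  2 ^ n + (2 ^ n + 0)     ∎
  where open ≤-Reasoning

∸-≡ : ∀ {m n o} → m + n ≡ o → o ∸ n ≡ m
∸-≡ {m} {n} refl = m+n∸n≡m m n

linked-<-head : ∀ {v vs} → Linked _<_ (v ∷ vs) → All (v <_) vs
linked-<-head [-]          = []
linked-<-head (v<w ∷ rest) = Linked⇒All <-trans v<w rest

linked-<-head+length : ∀ {v vs d} → Linked _<_ (v ∷ vs) → All (_< d) (v ∷ vs) → v + length vs < d
linked-<-head+length {v} {[]}     _            (v<d ∷ []) = subst (_< _) (sym (+-identityʳ v)) v<d
linked-<-head+length {v} {w ∷ vs} {d} (v<w ∷ rest) (_ ∷ bounded) = begin-strict
  v + suc (length vs) ≡⟨ +-suc v (length vs) ⟩
  suc v + length vs   ≤⟨ +-monoˡ-≤ (length vs) v<w ⟩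
  w + length vs       <⟨ linked-<-head+length rest bounded ⟩
  d                   ∎
  where open ≤-Reasoning

increasing-range : ∀ n {a vs} → Linked _<_ vs → All (a ≤_) vs → All (_< a + n) vs →
                   length vs ≡ n → vs ≡ applyUpTo (a +_) n
increasing-range zero    {vs = []}     _   _             _     _   = refl
increasing-range (suc n) {a} {v ∷ vs} inc (a≤v ∷ lower) upper len = cong₂ _∷_ v≡a+0 tail≡
  where
    v+n<a+1+n : v + n < a + suc n
    v+n<a+1+n = subst (λ l → v + l < a + suc n) (suc-injective len) (linked-<-head+length inc upper)
    v≡a : v ≡ a
    v≡a = ≤-antisym (+-cancelʳ-≤ n v a (≤-pred (subst (suc (v + n) ≤_) (+-suc a n) v+n<a+1+n))) a≤v
    v≡a+0 : v ≡ a + 0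
    v≡a+0 = trans v≡a (sym (+-identityʳ a))
    tail≡ : vs ≡ applyUpTo (λ i → a + suc i) n
    tail≡ = trans
      (increasing-range n (Data.List.Relation.Unary.Linked.tail inc)
        (subst (λ x → All (x <_) vs) v≡a (linked-<-head inc))
        (subst (λ d → All (_< d) vs) (+-suc a n) (Data.List.Relation.Unary.All.tail upper))
        (suc-injective len))
      (applyUpTo-cong n (λ {i} _ → sym (+-suc a i)))

-- Binary values of words, most significant bit first

bit : Bool → ℕ
bit false = 0
bit true  = 1

val : List Bool → ℕ
val []      = 0
val (b ∷ w) = bit b * 2 ^ length w + val w

val<2^length : ∀ w → val w < 2 ^ length w
val<2^length []          = z<s
val<2^length (false ∷ w) = ≤-trans (val<2^length w) (m≤m+n (2 ^ length w) _)
val<2^length (true ∷ w)  = begin-strict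
  2 ^ length w + 0 + val w  ≡⟨ cong (_+ val w) (+-identityʳ _) ⟩
  2 ^ length w + val w      <⟨ +-monoʳ-< (2 ^ length w) (≤-trans (val<2^length w) (m≤m+n _ 0)) ⟩
  2 ^ length w + (2 ^ length w + 0) ∎
  where open ≤-Reasoning

val-false<val-true : ∀ {w w'} → length w ≡ length w' → val (false ∷ w) < val (true ∷ w')
val-false<val-true {w} {w'} eq = begin-strict
  val w                   <⟨ val<2^length w ⟩
  2 ^ length w            ≡⟨ cong (2 ^_) eq ⟩
  2 ^ length w'           ≤⟨ m≤m+n (2 ^ length w') 0 ⟩
  2 ^ length w' + 0       ≤⟨ m≤m+n _ (val w') ⟩
  val (true ∷ w')         ∎
  where open ≤-Reasoning

val-injective : ∀ {w w'} → length w ≡ length w' → val w ≡ val w' → w ≡ w'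
val-injective {[]}        {[]}         _  _ = refl
val-injective {false ∷ w} {false ∷ w'} eq v = cong (false ∷_) (val-injective (suc-injective eq) v)
val-injective {true ∷ w}  {true ∷ w'}  eq v = cong (true ∷_) (val-injective eq' (+-cancelˡ-≡ (2 ^ length w + 0) _ _ v'))
  where
    eq' : length w ≡ length w'
    eq' = suc-injective eq
    v' : 2 ^ length w + 0 + val w ≡ 2 ^ length w + 0 + val w'
    v' = trans v (cong (λ n → 2 ^ n + 0 + val w') (sym eq'))
val-injective {false ∷ w} {true ∷ w'}  eq v = ⊥-elim (<-irrefl v (val-false<val-true {w} {w'} (suc-injective eq)))
val-injective {true ∷ w}  {false ∷ w'} eq v = ⊥-elim (<-irrefl (sym v) (val-false<val-true {w'} {w} (sym (suc-injective eq))))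

val-++ : ∀ u v → val (u ++ v) ≡ val u * 2 ^ length v + val v
val-++ []      v = refl
val-++ (a ∷ u) v = begin
  bit a * 2 ^ length (u ++ v) + val (u ++ v)
    ≡⟨ cong₂ (λ p q → bit a * 2 ^ p + q) (length-++ u) (val-++ u v) ⟩
  bit a * 2 ^ (length u + length v) + (val u * 2 ^ length v + val v)
    ≡⟨ cong (λ p → bit a * p + (val u * 2 ^ length v + val v)) (^-distribˡ-+-* 2 (length u) (length v)) ⟩
  bit a * (2 ^ length u * 2 ^ length v) + (val u * 2 ^ length v + val v)
    ≡⟨ regroup (bit a) (2 ^ length u) (2 ^ length v) (val u) (val v) ⟩
  (bit a * 2 ^ length u + val u) * 2 ^ length v + val v ∎
  where
    open ≡-Reasoning
    regroup : ∀ a p q x y → a * (p * q) + (x * q + y) ≡ (a * p + x) * q + y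
    regroup = solve-∀

val-replicate-false : ∀ n → val (replicate n false) ≡ 0
val-replicate-false zero    = refl
val-replicate-false (suc n) = val-replicate-false n

val-map-not : ∀ w → val (map not w) + suc (val w) ≡ 2 ^ length w
val-map-not []      = refl
val-map-not (b ∷ w) = begin
  bit (not b) * 2 ^ length (map not w) + a + suc (bit b * P + c)
    ≡⟨ cong (λ n → bit (not b) * 2 ^ n + a + suc (bit b * P + c)) (length-map not w) ⟩
  bit (not b) * P + a + suc (bit b * P + c)   ≡⟨ regroup (bit (not b)) (bit b) P a c ⟩
  (bit (not b) + bit b) * P + (a + suc c)     ≡⟨ cong₂ (λ x y → x * P + y) (bit-not+bit b) (val-map-not w) ⟩
  (P + 0) + P                                 ≡⟨ +-comm (P + 0) P ⟩
  2 ^ suc (length w)                          ∎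
  where
    open ≡-Reasoning
    P = 2 ^ length w
    a = val (map not w)
    c = val w
    bit-not+bit : ∀ b → bit (not b) + bit b ≡ 1
    bit-not+bit false = refl
    bit-not+bit true  = refl
    regroup : ∀ x y p a c → x * p + a + suc (y * p + c) ≡ (x + y) * p + (a + suc c)
    regroup = solve-∀

_≤ₗₑₓ_ : List Bool → List Bool → Set
_≤ₗₑₓ_ = DecTotalOrder._≤_ lexOrder

val-take-mono : ∀ n {r r'} → r ≤ₗₑₓ r' → n ≤ length r → n ≤ length r' → val (take n r) ≤ val (take n r')
val-take-mono zero    _ _ _ = z≤n
val-take-mono (suc n) {[]}    _ () _
val-take-mono (suc n) {_ ∷ _} {[]} _ _ ()
val-take-mono (suc n) {false ∷ r} {true ∷ r'} (this (f≤t , _)) (s≤s p) (s≤s p') =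
  <⇒≤ (val-false<val-true {take n r} {take n r'} (trans (length-take-≤ p) (sym (length-take-≤ p'))))
val-take-mono (suc n) {_ ∷ _} {_ ∷ _} (this (b≤b , a≢a)) _ _ = ⊥-elim (a≢a refl)
val-take-mono (suc n) {a ∷ r} {.a ∷ r'} (next refl lex) (s≤s p) (s≤s p') = begin
  bit a * 2 ^ length (take n r) + val (take n r)
    ≡⟨ cong (λ l → bit a * 2 ^ l + val (take n r)) (trans (length-take-≤ p) (sym (length-take-≤ p'))) ⟩
  bit a * 2 ^ length (take n r') + val (take n r)
    ≤⟨ +-monoʳ-≤ _ (val-take-mono n lex p p') ⟩
  bit a * 2 ^ length (take n r') + val (take n r') ∎
  where open ≤-Reasoning

val-take-increasing : ∀ n {rs} → Linked _≤ₗₑₓ_ rs → AllPairs (λ r r' → val (take n r) ≢ val (take n r')) rs →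
                      All (λ r → n ≤ length r) rs → Linked _<_ (map (val ∘ take n) rs)
val-take-increasing n []                 _                   _                = []
val-take-increasing n [-]                _                   _                = [-]
val-take-increasing n (r≤r' ∷ sorted) ((r≢r' ∷ _) ∷ distinct) (n≤r ∷ n≤r' ∷ long) =
  ≤∧≢⇒< (val-take-mono n r≤r' n≤r n≤r') r≢r' ∷ val-take-increasing n sorted distinct (n≤r' ∷ long)

odd : ℕ → Bool
odd zero          = false
odd (suc zero)    = true
odd (suc (suc n)) = odd n

odd-*4+ : ∀ c w → odd (c * 4 + w) ≡ odd w
odd-*4+ zero    w = refl
odd-*4+ (suc c) w = odd-*4+ c w

odd-⌊*4+/2⌋ : ∀ c w → odd ⌊ c * 4 + w /2⌋ ≡ odd ⌊ w /2⌋
odd-⌊*4+/2⌋ zero    w = refl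
odd-⌊*4+/2⌋ (suc c) w = odd-⌊*4+/2⌋ c w

odd-xor-odd-⌊/2⌋ : ∀ u c d → (odd (val (u ++ c ∷ d ∷ [])) xor odd ⌊ val (u ++ c ∷ d ∷ []) /2⌋) ≡ d xor c
odd-xor-odd-⌊/2⌋ u c d rewrite val-++ u (c ∷ d ∷ []) | odd-*4+ (val u) (val (c ∷ d ∷ []))
                              | odd-⌊*4+/2⌋ (val u) (val (c ∷ d ∷ [])) with c | d
... | false | false = refl
... | false | true  = refl
... | true  | false = refl
... | true  | true  = refl

-- Polynomials over F₂ and the shift registers

xor-cancelʳ : ∀ b {a a'} → a xor b ≡ a' xor b → a ≡ a'
xor-cancelʳ b {false} {false} _  = refl
xor-cancelʳ b {true}  {true}  _  = refl
xor-cancelʳ b {false} {true}  eq = ⊥-elim (Boolₚ.not-¬ refl eq)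
xor-cancelʳ b {true}  {false} eq = ⊥-elim (Boolₚ.not-¬ refl (sym eq))

coeff-+ₚ : ∀ p q i → coeff (p +ₚ q) i ≡ coeff p i xor coeff q i
coeff-+ₚ []      q       i       = refl
coeff-+ₚ (a ∷ p) []      i       = sym (Boolₚ.xor-identityʳ _)
coeff-+ₚ (a ∷ p) (b ∷ q) zero    = refl
coeff-+ₚ (a ∷ p) (b ∷ q) (suc i) = coeff-+ₚ p q i

coeff-Xpow : ∀ n i → coeff (Xpow n) i ≡ does (i ≟ n)
coeff-Xpow zero    zero    = refl
coeff-Xpow zero    (suc i) = refl
coeff-Xpow (suc n) zero    = refl
coeff-Xpow (suc n) (suc i) = coeff-Xpow n i

coeff-T : ∀ k i → coeff (T k) i ≡ (does (i ≟ k) xor does (i ≟ 1)) xor does (i ≟ 0)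
coeff-T k i = begin
  coeff (Xpow k +ₚ Xpow 1 +ₚ oneₚ) i                   ≡⟨ coeff-+ₚ (Xpow k +ₚ Xpow 1) oneₚ i ⟩
  coeff (Xpow k +ₚ Xpow 1) i xor coeff oneₚ i          ≡⟨ cong (_xor coeff oneₚ i) (coeff-+ₚ (Xpow k) (Xpow 1) i) ⟩
  (coeff (Xpow k) i xor coeff (Xpow 1) i) xor coeff (Xpow 0) i
    ≡⟨ cong₂ _xor_ (cong₂ _xor_ (coeff-Xpow k i) (coeff-Xpow 1 i)) (coeff-Xpow 0 i) ⟩
  (does (i ≟ k) xor does (i ≟ 1)) xor does (i ≟ 0)             ∎
  where open ≡-Reasoning

coeff-∷-*ₚ : ∀ a q f i → coeff ((a ∷ q) *ₚ f) i ≡ (a ∧ coeff f i) xor coeff (false ∷ (q *ₚ f)) i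
coeff-∷-*ₚ false q f i = coeff-+ₚ [] (false ∷ (q *ₚ f)) i
coeff-∷-*ₚ true  q f i = coeff-+ₚ f (false ∷ (q *ₚ f)) i

-- One step of the LFSR s_{t+k} = s_{t+1} ⊕ s_t on states (s_t, …, s_{t+k−1}).
lfsr : List Bool → List Bool
lfsr (a ∷ b ∷ r) = b ∷ (r ∷ʳ (a xor b))
lfsr x           = x

lfsr-injective : ∀ {x y} → lfsr x ≡ lfsr y → x ≡ y
lfsr-injective {[]}        {[]}          _  = refl
lfsr-injective {_ ∷ []}    {_ ∷ []}      eq = eq
lfsr-injective {[]}        {_ ∷ []}      ()
lfsr-injective {[]}        {_ ∷ _ ∷ _}   ()
lfsr-injective {a ∷ b ∷ r} {a' ∷ b' ∷ r'} eq with refl , eq′ ← ∷-injective eq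
  with refl , a⊕b≡a'⊕b ← ∷ʳ-injective r r' eq′ = cong (_∷ b ∷ r) (xor-cancelʳ b a⊕b≡a'⊕b)
lfsr-injective {_ ∷ []}    {_ ∷ _ ∷ r'}  eq
  with () ← ++-conicalʳ r' _ (sym (proj₂ (∷-injective eq)))
lfsr-injective {_ ∷ _ ∷ r} {_ ∷ []}      eq
  with () ← ++-conicalʳ r _ (proj₂ (∷-injective eq))

length-lfsr : ∀ x → length (lfsr x) ≡ length x
length-lfsr []          = refl
length-lfsr (_ ∷ [])    = refl
length-lfsr (a ∷ b ∷ r) = cong suc (trans (length-++ r) (+-comm (length r) 1))

feedback : List Bool → Bool
feedback (a ∷ b ∷ r) = (a xor b) xor δ (a ∷ b ∷ r)
feedback _           = false

length-F' : ∀ x → length (F' x) ≡ length x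
length-F' []          = refl
length-F' (_ ∷ [])    = refl
length-F' (a ∷ b ∷ r) = cong suc (trans (length-++ r) (+-comm (length r) 1))

F'≡lfsr : ∀ x → δ x ≡ false → F' x ≡ lfsr x
F'≡lfsr []          _       = refl
F'≡lfsr (_ ∷ [])    _       = refl
F'≡lfsr (a ∷ b ∷ r) δx≡false =
  cong (λ c → b ∷ (r ∷ʳ c)) (trans (cong ((a xor b) xor_) δx≡false) (Boolₚ.xor-identityʳ (a xor b)))

last-F' : ∀ a b r → last (F' (a ∷ b ∷ r)) ≡ just (feedback (a ∷ b ∷ r))
last-F' a b r = last-∷ʳ (b ∷ r) (feedback (a ∷ b ∷ r))

-- For n = 2^k, the last letter of the row of rank j in the sorted rotations of M_k.
column : ℕ → ℕ → Bool
column n j = not ((odd j xor odd ⌊ j /2⌋) xor does (n ≤? j + 2))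

module Register (m : ℕ) where

  k : ℕ
  k = suc (suc m)

  0ᵏ 10ᵏ⁻¹ 0ᵏ⁻¹1 : List Bool
  0ᵏ    = replicate k false
  10ᵏ⁻¹ = true ∷ replicate (suc m) false
  0ᵏ⁻¹1 = replicate (suc m) false ∷ʳ true

  orbit : ℕ → List Bool
  orbit zero    = 0ᵏ⁻¹1
  orbit (suc t) = lfsr (orbit t)

  length-orbit : ∀ t → length (orbit t) ≡ k
  length-orbit zero    = trans (length-++ (replicate (suc m) false))
                                (trans (cong (_+ 1) (length-replicate (suc m))) (+-comm (suc m) 1))
  length-orbit (suc t) = trans (length-lfsr (orbit t)) (length-orbit t)

  -- The residue of x^t modulo T_k, read off the state (s_t, …, s_{t+k−1}) of the LFSR: its constant
  -- coefficient is s_{t+k−1} ⊕ s_t and its coefficient of x^{j+1} is s_{t+k−2−j}.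
  residue : List Bool → ℕ → Bool
  residue x zero    = (x ! suc m) xor (x ! 0)
  residue x (suc j) = if does (j ≤? m) then x ! (m ∸ j) else false

  0ᵏ⁻¹1-!-last : 0ᵏ⁻¹1 ! suc m ≡ true
  0ᵏ⁻¹1-!-last = subst (λ n → 0ᵏ⁻¹1 ! n ≡ true) (length-replicate (suc m)) (∷ʳ-!-length (replicate (suc m) false) true)

  residue-0ᵏ⁻¹1 : ∀ i → residue 0ᵏ⁻¹1 i ≡ does (i ≟ 0)
  residue-0ᵏ⁻¹1 zero    = cong (_xor false) 0ᵏ⁻¹1-!-last
  residue-0ᵏ⁻¹1 (suc j) with does (j ≤? m)
  ... | false = refl
  ... | true  = trans (∷ʳ-!-< (replicate (suc m) false) true
                                (subst (m ∸ j <_) (sym (length-replicate (suc m))) (s≤s (m∸n≤m m j))))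
                      (replicate-false-! (suc m) (m ∸ j))

  lfsr-! : ∀ a b {r} → length r ≡ m → ∀ {j} → j ≤ m → lfsr (a ∷ b ∷ r) ! j ≡ (a ∷ b ∷ r) ! suc j
  lfsr-! a b {r} |r|≡m j≤m = ∷ʳ-!-< (b ∷ r) (a xor b) (s≤s (subst (_ ≤_) (sym |r|≡m) j≤m))

  lfsr-!-last : ∀ a b {r} → length r ≡ m → lfsr (a ∷ b ∷ r) ! suc m ≡ a xor b
  lfsr-!-last a b {r} |r|≡m = subst (λ n → (r ∷ʳ (a xor b)) ! n ≡ a xor b) |r|≡m (∷ʳ-!-length r (a xor b))

  -- Multiplying the residue of a state a ∷ b ∷ r by x gives the residue of the next state
  -- plus a · T_k.
  residue-lfsr-zero : ∀ a b r → length r ≡ m →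
                      false ≡ (a ∧ coeff (T k) 0) xor residue (lfsr (a ∷ b ∷ r)) 0
  residue-lfsr-zero a b r |r|≡m rewrite coeff-T k 0 =
    subst (λ c → false ≡ (a ∧ true) xor (c xor b)) (sym (lfsr-!-last a b {r} |r|≡m)) (cancel a b)
    where
      cancel : ∀ a b → false ≡ (a ∧ true) xor ((a xor b) xor b)
      cancel false false = refl
      cancel false true  = refl
      cancel true  false = refl
      cancel true  true  = refl

  residue-lfsr-suc : ∀ a b r → length r ≡ m → ∀ i →
                     residue (a ∷ b ∷ r) i ≡ (a ∧ coeff (T k) (suc i)) xor residue (lfsr (a ∷ b ∷ r)) (suc i)
  residue-lfsr-suc a b r |r|≡m zero rewrite coeff-T k 1 =
    trans (swap a ((a ∷ b ∷ r) ! suc m)) (cong ((a ∧ true) xor_) (sym (lfsr-! a b |r|≡m ≤-refl)))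
    where
      swap : ∀ a c → c xor a ≡ (a ∧ true) xor c
      swap false c = Boolₚ.xor-identityʳ c
      swap true  c = Boolₚ.xor-comm c true
  residue-lfsr-suc a b r |r|≡m (suc j) rewrite coeff-T k (suc (suc j)) with <-cmp j m
  ... | tri< j<m j≢m _
        rewrite dec-true (j ≤? m) (<⇒≤ j<m) | dec-true (suc j ≤? m) j<m | dec-false (j ≟ m) j≢m
              | Boolₚ.∧-zeroʳ a =
    trans (cong ((a ∷ b ∷ r) !_) (+-∸-assoc 1 j<m)) (sym (lfsr-! a b |r|≡m (m∸n≤m m (suc j))))
  ... | tri≈ _ refl _
        rewrite dec-true (j ≤? j) ≤-refl | dec-false (suc j ≤? j) (n≮n j) | dec-true (j ≟ j) refl
              | n∸n≡0 j | Boolₚ.∧-identityʳ a = sym (Boolₚ.xor-identityʳ a)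
  ... | tri> _ j≢m m<j
        rewrite dec-false (j ≤? m) (<⇒≱ m<j) | dec-false (suc j ≤? m) (<⇒≱ (m<n⇒m<1+n m<j))
              | dec-false (j ≟ m) j≢m | Boolₚ.∧-zeroʳ a = refl

  quotient : ℕ → Poly
  quotient zero    = []
  quotient (suc t) = (orbit t ! 0) ∷ quotient t

  residue-step : ∀ p q x → length x ≡ k →
                 (∀ i → coeff p i ≡ coeff (q *ₚ T k) i xor residue x i) →
                 ∀ i → coeff (false ∷ p) i ≡ coeff ((x ! 0 ∷ q) *ₚ T k) i xor residue (lfsr x) i
  residue-step p q (a ∷ b ∷ r) |x|≡k _ zero = begin
    false
      ≡⟨ residue-lfsr-zero a b r |r|≡m ⟩
    (a ∧ coeff (T k) 0) xor R
      ≡⟨ cong (_xor R) (Boolₚ.xor-identityʳ (a ∧ coeff (T k) 0)) ⟨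
    ((a ∧ coeff (T k) 0) xor false) xor R
      ≡⟨ cong (_xor R) (coeff-∷-*ₚ a q (T k) 0) ⟨
    coeff ((a ∷ q) *ₚ T k) 0 xor R ∎
    where
      open ≡-Reasoning
      |r|≡m : length r ≡ m
      |r|≡m = suc-injective (suc-injective |x|≡k)
      R = residue (lfsr (a ∷ b ∷ r)) 0
  residue-step p q (a ∷ b ∷ r) |x|≡k inv (suc i) = begin
    coeff p i                ≡⟨ inv i ⟩
    X xor residue (a ∷ b ∷ r) i ≡⟨ cong (X xor_) (residue-lfsr-suc a b r |r|≡m i) ⟩
    X xor (A xor R)          ≡⟨ Boolₚ.xor-assoc X A R ⟨
    (X xor A) xor R          ≡⟨ cong (_xor R) (Boolₚ.xor-comm X A) ⟩
    (A xor X) xor R          ≡⟨ cong (_xor R) (coeff-∷-*ₚ a q (T k) (suc i)) ⟨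
    coeff ((a ∷ q) *ₚ T k) (suc i) xor R ∎
    where
      open ≡-Reasoning
      |r|≡m : length r ≡ m
      |r|≡m = suc-injective (suc-injective |x|≡k)
      X = coeff (q *ₚ T k) i
      A = a ∧ coeff (T k) (suc i)
      R = residue (lfsr (a ∷ b ∷ r)) (suc i)

  Xpow≡quotient*T+residue : ∀ t i → coeff (Xpow t) i ≡ coeff (quotient t *ₚ T k) i xor residue (orbit t) i
  Xpow≡quotient*T+residue zero    i = trans (coeff-Xpow 0 i) (sym (residue-0ᵏ⁻¹1 i))
  Xpow≡quotient*T+residue (suc t)   =
    residue-step (Xpow t) (quotient t) (orbit t) (length-orbit t) (Xpow≡quotient*T+residue t)

  orbit-returns⇒T∣ : ∀ n → orbit n ≡ 0ᵏ⁻¹1 → T k ∣ₚ (Xpow n +ₚ oneₚ)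
  orbit-returns⇒T∣ n returns = quotient n , λ i → sym (cancel i)
    where
      cancel : ∀ i → coeff (Xpow n +ₚ oneₚ) i ≡ coeff (quotient n *ₚ T k) i
      cancel i = begin
        coeff (Xpow n +ₚ oneₚ) i      ≡⟨ coeff-+ₚ (Xpow n) oneₚ i ⟩
        coeff (Xpow n) i xor coeff oneₚ i
          ≡⟨ cong₂ _xor_ (Xpow≡quotient*T+residue n i) (coeff-Xpow 0 i) ⟩
        (X xor residue (orbit n) i) xor does (i ≟ 0)
          ≡⟨ cong (λ x → (X xor residue x i) xor does (i ≟ 0)) returns ⟩
        (X xor residue 0ᵏ⁻¹1 i) xor does (i ≟ 0)
          ≡⟨ cong (λ c → (X xor c) xor does (i ≟ 0)) (residue-0ᵏ⁻¹1 i) ⟩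
        (X xor does (i ≟ 0)) xor does (i ≟ 0)
          ≡⟨ Boolₚ.xor-assoc X (does (i ≟ 0)) (does (i ≟ 0)) ⟩
        X xor (does (i ≟ 0) xor does (i ≟ 0))
          ≡⟨ cong (X xor_) (Boolₚ.xor-same (does (i ≟ 0))) ⟩
        X xor false
          ≡⟨ Boolₚ.xor-identityʳ X ⟩
        X ∎
        where
          open ≡-Reasoning
          X = coeff (quotient n *ₚ T k) i

  orbit-≢-0ᵏ : ∀ t → orbit t ≢ 0ᵏ
  orbit-≢-0ᵏ zero    eq with () ← trans (sym 0ᵏ⁻¹1-!-last) (trans (cong (_! suc m) eq) (replicate-false-! k (suc m)))
  orbit-≢-0ᵏ (suc t) eq = orbit-≢-0ᵏ t (lfsr-injective (trans eq (sym (cong (false ∷_) (replicate-∷ʳ m false)))))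

  orbit-cancel : ∀ i j → orbit i ≡ orbit (i + j) → orbit 0 ≡ orbit j
  orbit-cancel zero    j eq = eq
  orbit-cancel (suc i) j eq = orbit-cancel i j (lfsr-injective eq)

  Y : ℕ → List Bool
  Y = y k

  S : ℕ → Bool
  S = s k

  length-Y : ∀ t → length (Y t) ≡ k
  length-Y zero    = length-replicate k
  length-Y (suc t) = trans (length-F' (Y t)) (length-Y t)

  take-suc-Y : ∀ t {j} → j ≤ suc m → take (suc j) (Y t) ≡ S t ∷ take j (Y (suc t))
  take-suc-Y t {j} j≤ = shift (Y t) (length-Y t)
    where
      shift : ∀ x → length x ≡ k → take (suc j) x ≡ headOr0 x ∷ take j (F' x)
      shift (a ∷ b ∷ r) |x| = cong (a ∷_) (sym (take-++ˡ (b ∷ r) _ (subst (j ≤_) (sym (suc-injective |x|)) j≤)))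

  Y-prefix : ∀ j t → j ≤ k → take j (Y t) ≡ applyUpTo (λ i → S (t + i)) j
  Y-prefix zero    t _         = refl
  Y-prefix (suc j) t (s≤s j≤) = begin
    take (suc j) (Y t)                       ≡⟨ take-suc-Y t j≤ ⟩
    S t ∷ take j (Y (suc t))                 ≡⟨ cong (S t ∷_) (Y-prefix j (suc t) (m≤n⇒m≤1+n j≤)) ⟩
    S t ∷ applyUpTo (λ i → S (suc t + i)) j
      ≡⟨ cong₂ _∷_ (cong S (sym (+-identityʳ t))) (applyUpTo-cong j (λ {i} _ → cong S (sym (+-suc t i)))) ⟩
    applyUpTo (λ i → S (t + i)) (suc j)      ∎
    where open ≡-Reasoning

  Y-window : ∀ t → Y t ≡ applyUpTo (λ j → S (t + j)) k
  Y-window t = trans (sym (take-all k (Y t) (≤-reflexive (length-Y t)))) (Y-prefix k t ≤-refl)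

  S-feedback : ∀ t → S (t + k) ≡ feedback (Y t)
  S-feedback t = just-injective (begin
    just (S (t + k))                          ≡⟨ cong (just ∘ S) (+-suc t (suc m)) ⟩
    just (S (suc t + suc m))                  ≡⟨ last-applyUpTo (λ j → S (suc t + j)) (suc m) ⟨
    last (applyUpTo (λ j → S (suc t + j)) k)  ≡⟨ cong last (Y-window (suc t)) ⟨
    last (F' (Y t))                           ≡⟨ last-F'-Y (Y t) (length-Y t) ⟩
    just (feedback (Y t))                     ∎)
    where
      open ≡-Reasoning
      last-F'-Y : ∀ x → length x ≡ k → last (F' x) ≡ just (feedback x)
      last-F'-Y (a ∷ b ∷ r) _ = last-F' a b r

  δ-spec : ∀ x → length x ≡ k → δ x ≡ does (≡-dec Boolₚ._≟_ x 0ᵏ) ∨ does (≡-dec Boolₚ._≟_ x 10ᵏ⁻¹)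
  δ-spec x |x| rewrite |x| = cong₂ _∨_ (isYes≗does (≡-dec Boolₚ._≟_ x 0ᵏ)) (isYes≗does (≡-dec Boolₚ._≟_ x 10ᵏ⁻¹))

  ≡⇔val-reverse-≡ : ∀ {x x'} → length x ≡ length x' → x ≡ x' ⇔ val (reverse x) ≡ val (reverse x')
  ≡⇔val-reverse-≡ {x} {x'} |x|≡|x'| = mk⇔ (cong (val ∘ reverse))
    (reverse-injective ∘ val-injective (trans (length-reverse x) (trans |x|≡|x'| (sym (length-reverse x')))))

  val-reverse-0ᵏ : val (reverse 0ᵏ) ≡ 0
  val-reverse-0ᵏ = trans (cong val (reverse-replicate k false)) (val-replicate-false k)

  val-reverse-10ᵏ⁻¹ : val (reverse 10ᵏ⁻¹) ≡ 1
  val-reverse-10ᵏ⁻¹ = begin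
    val (reverse (true ∷ replicate (suc m) false))     ≡⟨ cong val (unfold-reverse true (replicate (suc m) false)) ⟩
    val (reverse (replicate (suc m) false) ∷ʳ true)    ≡⟨ cong (λ w → val (w ∷ʳ true)) (reverse-replicate (suc m) false) ⟩
    val (replicate (suc m) false ∷ʳ true)              ≡⟨ val-++ (replicate (suc m) false) (true ∷ []) ⟩
    val (replicate (suc m) false) * 2 + 1              ≡⟨ cong (λ v → v * 2 + 1) (val-replicate-false (suc m)) ⟩
    1                                                   ∎
    where open ≡-Reasoning

  δ≡val-reverse≤1 : ∀ x → length x ≡ k → δ x ≡ does (val (reverse x) ≤? 1)
  δ≡val-reverse≤1 x |x| = begin
    δ x                                                             ≡⟨ δ-spec x |x| ⟩
    does (≡-dec Boolₚ._≟_ x 0ᵏ) ∨ does (≡-dec Boolₚ._≟_ x 10ᵏ⁻¹)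
      ≡⟨ cong₂ _∨_ (via-val 0ᵏ (length-replicate k) val-reverse-0ᵏ) (via-val 10ᵏ⁻¹ (cong suc (length-replicate (suc m))) val-reverse-10ᵏ⁻¹) ⟩
    does (v ≟ 0) ∨ does (v ≟ 1)                                     ≡⟨ ≤1-by-cases v ⟨
    does (v ≤? 1)                                                   ∎
    where
      open ≡-Reasoning
      v = val (reverse x)
      via-val : ∀ x' → length x' ≡ k → ∀ {c} → val (reverse x') ≡ c →
                does (≡-dec Boolₚ._≟_ x x') ≡ does (v ≟ c)
      via-val x' |x'| refl = does-⇔ (≡⇔val-reverse-≡ (trans |x| (sym |x'|))) (≡-dec Boolₚ._≟_ x x') (v ≟ val (reverse x'))
      ≤1-by-cases : ∀ v → does (v ≤? 1) ≡ does (v ≟ 0) ∨ does (v ≟ 1)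
      ≤1-by-cases zero          = refl
      ≤1-by-cases (suc zero)    = refl
      ≤1-by-cases (suc (suc v)) = refl

  -- The complemented reversal of x has value j with j + val (reverse x) + 1 = 2^k, so x is one of
  -- the two special states (val (reverse x) ≤ 1) exactly when 2^k ≤ j + 2.
  feedback-column : ∀ x → length x ≡ k → not (feedback x) ≡ column (2 ^ k) (val (map not (reverse x)))
  feedback-column (a ∷ b ∷ r) |x| = cong not (cong₂ _xor_ parity threshold)
    where
      x = a ∷ b ∷ r
      j = val (map not (reverse x))
      v = val (reverse x)
      low-bits : map not (reverse x) ≡ map not (reverse r) ++ not b ∷ not a ∷ []
      low-bits = trans (cong (map not) (reverse-++ (a ∷ b ∷ []) r)) (map-++ not (reverse r) (b ∷ a ∷ []))
      parity : a xor b ≡ odd j xor odd ⌊ j /2⌋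
      parity = begin
        a xor b                 ≡⟨ Boolₚ.xor-annihilates-not a b ⟨
        not a xor not b         ≡⟨ odd-xor-odd-⌊/2⌋ (map not (reverse r)) (not b) (not a) ⟨
        odd (val (map not (reverse r) ++ not b ∷ not a ∷ [])) xor odd ⌊ val (map not (reverse r) ++ not b ∷ not a ∷ []) /2⌋
          ≡⟨ cong (λ w → odd (val w) xor odd ⌊ val w /2⌋) low-bits ⟨
        odd j xor odd ⌊ j /2⌋   ∎
        where open ≡-Reasoning
      j+1+v≡2^k : j + suc v ≡ 2 ^ k
      j+1+v≡2^k = trans (val-map-not (reverse x)) (cong (2 ^_) (trans (length-reverse x) |x|))
      threshold : δ x ≡ does (2 ^ k ≤? j + 2)
      threshold = trans (δ≡val-reverse≤1 x |x|) (does-⇔ (mk⇔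
        (λ v≤1 → subst (_≤ j + 2) j+1+v≡2^k (+-monoʳ-≤ j (s≤s v≤1)))
        (λ 2^k≤j+2 → ≤-pred (+-cancelˡ-≤ j (suc v) 2 (subst (_≤ j + 2) (sym j+1+v≡2^k) 2^k≤j+2))))
        (v ≤? 1) (2 ^ k ≤? j + 2))

module PrimitiveRegister (m : ℕ) (T-primitive : Primitive (suc (suc m)) (T (suc (suc m)))) where

  open Register m public

  N : ℕ
  N = 2 ^ k

  instance
    N-nonZero : NonZero N
    N-nonZero = m^n≢0 2 k

  k<N : k < N
  k<N = n<2^n k

  N∸1≡1+N∸2 : N ∸ 1 ≡ suc (N ∸ 2)
  N∸1≡1+N∸2 = +-∸-assoc 1 (≤-trans (s≤s (s≤s z≤n)) (<⇒≤ k<N))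

  N≡1+N∸1 : N ≡ suc (N ∸ 1)
  N≡1+N∸1 = sym (m+[n∸m]≡n (m^n>0 2 k))

  orbit-no-early-return : ∀ {n} → 0 < n → n < N ∸ 1 → orbit n ≢ 0ᵏ⁻¹1
  orbit-no-early-return {n} 0<n n<N∸1 returns = proj₂ (proj₂ T-primitive) n 0<n n<N∸1 (orbit-returns⇒T∣ n returns)

  orbit-injective : ∀ {i j} → i < j → j < N ∸ 1 → orbit i ≢ orbit j
  orbit-injective {i} {j} i<j j<N∸1 eq = orbit-no-early-return (m<n⇒0<n∸m i<j) (≤-<-trans (m∸n≤m j i) j<N∸1)
    (sym (orbit-cancel i (j ∸ i) (trans eq (cong orbit (sym (m+[n∸m]≡n (<⇒≤ i<j)))))))

  val-orbit≢0 : ∀ t → val (orbit t) ≢ 0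
  val-orbit≢0 t v≡0 = orbit-≢-0ᵏ t
    (val-injective (trans (length-orbit t) (sym (length-replicate k))) (trans v≡0 (sym (val-replicate-false k))))

  val-orbit<N : ∀ t → val (orbit t) < N
  val-orbit<N t = subst (λ n → val (orbit t) < 2 ^ n) (length-orbit t) (val<2^length (orbit t))

  -- The N states orbit 0, …, orbit (N − 1) are nonzero words of length k, so two of them coincide.
  orbit-code : Fin N → Fin (N ∸ 1)
  orbit-code t = fromℕ< (∸-monoˡ-< (val-orbit<N (toℕ t)) (n≢0⇒n>0 (val-orbit≢0 (toℕ t))))

  orbit-code-injective : ∀ i j → orbit-code i ≡ orbit-code j → orbit (toℕ i) ≡ orbit (toℕ j)
  orbit-code-injective i j same-code = val-injective (trans (length-orbit (toℕ i)) (sym (length-orbit (toℕ j))))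
    (∸-cancelʳ-≡ (n≢0⇒n>0 (val-orbit≢0 (toℕ i))) (n≢0⇒n>0 (val-orbit≢0 (toℕ j)))
      (trans (sym (toℕ-fromℕ< _)) (trans (cong toℕ same-code) (toℕ-fromℕ< _))))

  orbit-returns : ∃ λ d → 0 < d × d ≤ N ∸ 1 × orbit d ≡ 0ᵏ⁻¹1
  orbit-returns with pigeonhole (∸-monoʳ-< z<s (m^n>0 2 k)) orbit-code
  ... | i , j , i<j , same-code = toℕ j ∸ toℕ i , m<n⇒0<n∸m i<j
    , ≤-trans (m∸n≤m (toℕ j) (toℕ i)) (≤-pred (subst (toℕ j <_) N≡1+N∸1 (toℕ<n j)))
    , sym (orbit-cancel (toℕ i) (toℕ j ∸ toℕ i)
                        (trans (orbit-code-injective i j same-code) (cong orbit (sym (m+[n∸m]≡n (<⇒≤ i<j))))))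

  orbit-period : orbit (N ∸ 1) ≡ 0ᵏ⁻¹1
  orbit-period with orbit-returns
  ... | d , 0<d , d≤N∸1 , returns with m≤n⇒m<n∨m≡n d≤N∸1
  ...   | inj₁ d<N∸1 = ⊥-elim (orbit-no-early-return 0<d d<N∸1 returns)
  ...   | inj₂ refl  = returns

  orbit-N∸2 : orbit (N ∸ 2) ≡ 10ᵏ⁻¹
  orbit-N∸2 = lfsr-injective (trans (cong orbit (sym N∸1≡1+N∸2)) orbit-period)

  orbit-≢-10ᵏ⁻¹ : ∀ {t} → suc t < N ∸ 1 → orbit t ≢ 10ᵏ⁻¹
  orbit-≢-10ᵏ⁻¹ t+1<N∸1 eq = orbit-no-early-return z<s t+1<N∸1 (cong lfsr eq)

  δ-0ᵏ : δ 0ᵏ ≡ true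
  δ-0ᵏ = trans (δ-spec 0ᵏ (length-replicate k)) (cong (_∨ _) (dec-true (≡-dec Boolₚ._≟_ 0ᵏ 0ᵏ) refl))

  δ-10ᵏ⁻¹ : δ 10ᵏ⁻¹ ≡ true
  δ-10ᵏ⁻¹ = trans (δ-spec 10ᵏ⁻¹ (cong suc (length-replicate (suc m))))
                  (trans (cong (does (≡-dec Boolₚ._≟_ 10ᵏ⁻¹ 0ᵏ) ∨_) (dec-true (≡-dec Boolₚ._≟_ 10ᵏ⁻¹ 10ᵏ⁻¹) refl))
                         (Boolₚ.∨-zeroʳ (does (≡-dec Boolₚ._≟_ 10ᵏ⁻¹ 0ᵏ))))

  δ-orbit : ∀ {t} → suc t < N ∸ 1 → δ (orbit t) ≡ false
  δ-orbit {t} t+1<N∸1 = trans (δ-spec (orbit t) (length-orbit t))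
    (cong₂ _∨_ (dec-false (≡-dec Boolₚ._≟_ (orbit t) 0ᵏ) (orbit-≢-0ᵏ t))
               (dec-false (≡-dec Boolₚ._≟_ (orbit t) 10ᵏ⁻¹) (orbit-≢-10ᵏ⁻¹ t+1<N∸1)))

  -- Cycle-joining inserts 0ᵏ between 10ᵏ⁻¹ and 0ᵏ⁻¹1 in the cycle of the LFSR.
  Y-suc≡orbit : ∀ {t} → t < N ∸ 1 → Y (suc t) ≡ orbit t
  Y-suc≡orbit {zero}  _         = cong (λ c → false ∷ (replicate m false ∷ʳ c)) δ-0ᵏ
  Y-suc≡orbit {suc t} t+1<N∸1 = trans (cong F' (Y-suc≡orbit (<-trans (n<1+n t) t+1<N∸1)))
                                      (F'≡lfsr (orbit t) (δ-orbit t+1<N∸1))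

  Y-N : Y N ≡ 0ᵏ
  Y-N = begin
    Y N                  ≡⟨ cong Y N≡1+N∸1 ⟩
    F' (Y (N ∸ 1))       ≡⟨ cong (F' ∘ Y) N∸1≡1+N∸2 ⟩
    F' (Y (suc (N ∸ 2))) ≡⟨ cong F' (Y-suc≡orbit (subst (N ∸ 2 <_) (sym N∸1≡1+N∸2) (n<1+n (N ∸ 2)))) ⟩
    F' (orbit (N ∸ 2))   ≡⟨ cong F' orbit-N∸2 ⟩
    F' 10ᵏ⁻¹             ≡⟨ cong (λ c → false ∷ (replicate m false ∷ʳ c)) (cong ((true xor false) xor_) δ-10ᵏ⁻¹) ⟩
    false ∷ (replicate m false ∷ʳ false) ≡⟨ cong (false ∷_) (replicate-∷ʳ m false) ⟩
    0ᵏ                   ∎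
    where open ≡-Reasoning

  Y-periodic : ∀ t → Y (t + N) ≡ Y t
  Y-periodic zero    = Y-N
  Y-periodic (suc t) = cong F' (Y-periodic t)

  S-periodic : ∀ t → S (t + N) ≡ S t
  S-periodic t = cong headOr0 (Y-periodic t)

  Y-+*N : ∀ r q → Y (r + q * N) ≡ Y r
  Y-+*N r zero    = cong Y (+-identityʳ r)
  Y-+*N r (suc q) = begin
    Y (r + (N + q * N)) ≡⟨ cong Y (trans (cong (r +_) (+-comm N (q * N))) (sym (+-assoc r (q * N) N))) ⟩
    Y (r + q * N + N)   ≡⟨ Y-periodic (r + q * N) ⟩
    Y (r + q * N)       ≡⟨ Y-+*N r q ⟩
    Y r                 ∎
    where open ≡-Reasoning

  Y-injective-within-period : ∀ {a a'} → a < a' → a' < N → Y a ≢ Y a'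
  Y-injective-within-period {zero}  {suc a'} _ a'+1<N eq =
    orbit-≢-0ᵏ a' (trans (sym (Y-suc≡orbit a'<N∸1)) (sym eq))
    where
      a'<N∸1 : a' < N ∸ 1
      a'<N∸1 = ≤-pred (subst (suc a' <_) N≡1+N∸1 a'+1<N)
  Y-injective-within-period {suc a} {suc a'} (s≤s a<a') a'+1<N eq =
    orbit-injective a<a' a'<N∸1 (trans (sym (Y-suc≡orbit (<-trans a<a' a'<N∸1))) (trans eq (Y-suc≡orbit a'<N∸1)))
    where
      a'<N∸1 : a' < N ∸ 1
      a'<N∸1 = ≤-pred (subst (suc a' <_) N≡1+N∸1 a'+1<N)

  Y-injective-mod : ∀ a {d} → 0 < d → d < N → Y a ≢ Y (a + d)
  Y-injective-mod a {d} 0<d d<N eq = wrapped (m%n<n a N) (begin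
    Y r                ≡⟨ Y-+*N r q ⟨
    Y (r + q * N)      ≡⟨ cong Y (m≡m%n+[m/n]*n a N) ⟨
    Y a                ≡⟨ eq ⟩
    Y (a + d)          ≡⟨ cong (λ a → Y (a + d)) (m≡m%n+[m/n]*n a N) ⟩
    Y (r + q * N + d)  ≡⟨ cong Y (+-assoc r (q * N) d) ⟩
    Y (r + (q * N + d)) ≡⟨ cong (λ n → Y (r + n)) (+-comm (q * N) d) ⟩
    Y (r + (d + q * N)) ≡⟨ cong Y (+-assoc r d (q * N)) ⟨
    Y (r + d + q * N)  ≡⟨ Y-+*N (r + d) q ⟩
    Y (r + d)          ∎)
    where
      open ≡-Reasoning
      r = a % N
      q = a / N
      wrapped : ∀ {r} → r < N → Y r ≡ Y (r + d) → ⊥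
      wrapped {r} r<N Yr≡Yr+d with r + d <? N
      ... | yes r+d<N = Y-injective-within-period (m<m+n r 0<d) r+d<N Yr≡Yr+d
      ... | no  r+d≮N = Y-injective-within-period r+d∸N<r r<N
                          (sym (trans Yr≡Yr+d (trans (cong Y (sym (m∸n+n≡m N≤r+d))) (Y-periodic (r + d ∸ N)))))
        where
          N≤r+d : N ≤ r + d
          N≤r+d = ≮⇒≥ r+d≮N
          r+d∸N<r : r + d ∸ N < r
          r+d∸N<r = subst (r + d ∸ N <_) (m+n∸n≡m r N) (∸-monoˡ-< (+-monoʳ-< r d<N) N≤r+d)

  -- The rotations of M_k and their windows of length k

  -- Position j of M_k; the index 2N − 1 − j stays untruncated for all j < 2N.
  mirrored : ℕ → Bool
  mirrored j = not (S (N + N ∸ suc j))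

  S-unwrap : ∀ {j} → j < N → S (N + N ∸ suc j) ≡ S (N ∸ suc j)
  S-unwrap {j} j<N = trans (cong S (+-∸-comm N j<N)) (S-periodic (N ∸ suc j))

  M≡applyUpTo-mirrored : M k ≡ applyUpTo mirrored N
  M≡applyUpTo-mirrored = begin
    map not (reverse (map S (upTo N)))             ≡⟨ cong (map not ∘ reverse) (map-upTo S N) ⟩
    map not (reverse (applyUpTo S N))              ≡⟨ cong (map not) (reverse-applyUpTo S N) ⟩
    map not (applyDownFrom S N)                    ≡⟨ cong (map not) (applyDownFrom-applyUpTo S N) ⟩
    map not (applyUpTo (λ j → S (N ∸ suc j)) N)    ≡⟨ map-applyUpTo (λ j → S (N ∸ suc j)) not N ⟩
    applyUpTo (λ j → not (S (N ∸ suc j))) N        ≡⟨ applyUpTo-cong N (cong not ∘ sym ∘ S-unwrap) ⟩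
    applyUpTo mirrored N                           ∎
    where open ≡-Reasoning

  mirrored-periodic : ∀ {j} → j < N → mirrored (N + j) ≡ mirrored j
  mirrored-periodic {j} j<N = cong not (begin
    S (N + N ∸ suc (N + j)) ≡⟨ cong (λ n → S (N + N ∸ n)) (+-suc N j) ⟨
    S (N + N ∸ (N + suc j)) ≡⟨ cong S ([m+n]∸[m+o]≡n∸o N N (suc j)) ⟩
    S (N ∸ suc j)           ≡⟨ S-unwrap j<N ⟨
    S (N + N ∸ suc j)       ∎)
    where open ≡-Reasoning

  row : ℕ → List Bool
  row i = rotate i (M k)

  rotations-M : rotations (M k) ≡ applyUpTo row N
  rotations-M = trans (cong (λ n → map row (upTo n)) |M|≡N) (map-upTo row N)
    where |M|≡N = trans (cong length M≡applyUpTo-mirrored) (length-applyUpTo mirrored N)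

  row≡applyUpTo : ∀ {i} → i ≤ N → row i ≡ applyUpTo (mirrored ∘ (i +_)) N
  row≡applyUpTo {i} i≤N = trans (cong (rotate i) M≡applyUpTo-mirrored)
                            (rotate-applyUpTo mirrored i≤N (λ j<i → mirrored-periodic (<-≤-trans j<i i≤N)))

  -- Row i begins with the complemented reversal of the state at time start i.
  start : ℕ → ℕ
  start i = N + N ∸ (k + i)

  start+k+i : ∀ {i} → i < N → start i + (k + i) ≡ N + N
  start+k+i i<N = m∸n+n≡m (+-mono-≤ (<⇒≤ k<N) (<⇒≤ i<N))

  window-row : ∀ {i} → i < N → take k (row i) ≡ map not (reverse (Y (start i)))
  window-row {i} i<N = begin
    take k (row i)
      ≡⟨ cong (take k) (row≡applyUpTo (<⇒≤ i<N)) ⟩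
    take k (applyUpTo (mirrored ∘ (i +_)) N)
      ≡⟨ take-applyUpTo (mirrored ∘ (i +_)) (<⇒≤ k<N) ⟩
    applyUpTo (mirrored ∘ (i +_)) k
      ≡⟨ applyUpTo-cong k (cong (not ∘ S) ∘ index) ⟩
    applyUpTo (λ j → not (S (start i + (k ∸ suc j)))) k
      ≡⟨ map-applyUpTo (λ j → S (start i + (k ∸ suc j))) not k ⟨
    map not (applyUpTo (λ j → S (start i + (k ∸ suc j))) k)
      ≡⟨ cong (map not) (applyDownFrom-applyUpTo (λ j → S (start i + j)) k) ⟨
    map not (applyDownFrom (λ j → S (start i + j)) k)
      ≡⟨ cong (map not) (reverse-applyUpTo (λ j → S (start i + j)) k) ⟨
    map not (reverse (applyUpTo (λ j → S (start i + j)) k))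
      ≡⟨ cong (map not ∘ reverse) (Y-window (start i)) ⟨
    map not (reverse (Y (start i))) ∎
    where
      open ≡-Reasoning
      index : ∀ {j} → j < k → N + N ∸ suc (i + j) ≡ start i + (k ∸ suc j)
      index {j} j<k = ∸-≡ (begin
        start i + (k ∸ suc j) + suc (i + j)   ≡⟨ +-assoc (start i) (k ∸ suc j) (suc (i + j)) ⟩
        start i + (k ∸ suc j + suc (i + j))   ≡⟨ cong (λ n → start i + (k ∸ suc j + suc n)) (+-comm i j) ⟩
        start i + (k ∸ suc j + (suc j + i))   ≡⟨ cong (start i +_) (+-assoc (k ∸ suc j) (suc j) i) ⟨
        start i + (k ∸ suc j + suc j + i)     ≡⟨ cong (λ n → start i + (n + i)) (m∸n+n≡m j<k) ⟩
        start i + (k + i)                     ≡⟨ start+k+i i<N ⟩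
        N + N                                 ∎)

  last-row : ∀ {i} → i < N → last (row i) ≡ just (not (feedback (Y (start i))))
  last-row {i} i<N = begin
    last (row i)
      ≡⟨ cong last (row≡applyUpTo (<⇒≤ i<N)) ⟩
    last (applyUpTo (mirrored ∘ (i +_)) N)
      ≡⟨ cong (λ n → last (applyUpTo (mirrored ∘ (i +_)) n)) N≡1+N∸1 ⟩
    last (applyUpTo (mirrored ∘ (i +_)) (suc (N ∸ 1)))
      ≡⟨ last-applyUpTo (mirrored ∘ (i +_)) (N ∸ 1) ⟩
    just (not (S (N + N ∸ suc (i + (N ∸ 1)))))
      ≡⟨ cong (just ∘ not ∘ S) wrap ⟩
    just (not (S (N ∸ i)))
      ≡⟨ cong (just ∘ not) (S-periodic (N ∸ i)) ⟨
    just (not (S (N ∸ i + N)))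
      ≡⟨ cong (just ∘ not ∘ S) end ⟨
    just (not (S (start i + k)))
      ≡⟨ cong (just ∘ not) (S-feedback (start i)) ⟩
    just (not (feedback (Y (start i)))) ∎
    where
      open ≡-Reasoning
      N∸i+i≡N : N ∸ i + i ≡ N
      N∸i+i≡N = m∸n+n≡m (<⇒≤ i<N)
      wrap : N + N ∸ suc (i + (N ∸ 1)) ≡ N ∸ i
      wrap = ∸-≡ (begin
        N ∸ i + suc (i + (N ∸ 1))   ≡⟨ cong (N ∸ i +_) (+-suc i (N ∸ 1)) ⟨
        N ∸ i + (i + suc (N ∸ 1))   ≡⟨ cong (λ n → N ∸ i + (i + n)) N≡1+N∸1 ⟨
        N ∸ i + (i + N)             ≡⟨ +-assoc (N ∸ i) i N ⟨
        N ∸ i + i + N               ≡⟨ cong (_+ N) N∸i+i≡N ⟩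
        N + N                       ∎)
      end : start i + k ≡ N ∸ i + N
      end = +-cancelʳ-≡ i _ _ (begin
        start i + k + i     ≡⟨ +-assoc (start i) k i ⟩
        start i + (k + i)   ≡⟨ start+k+i i<N ⟩
        N + N               ≡⟨ cong (_+ N) N∸i+i≡N ⟨
        N ∸ i + i + N       ≡⟨ +-assoc (N ∸ i) i N ⟩
        N ∸ i + (i + N)     ≡⟨ cong (N ∸ i +_) (+-comm i N) ⟩
        N ∸ i + (N + i)     ≡⟨ +-assoc (N ∸ i) N i ⟨
        N ∸ i + N + i       ∎)

  -- Sorting the rotations of M_k

  key : List Bool → ℕ
  key = val ∘ take k

  length-row : ∀ {i} → i < N → length (row i) ≡ N
  length-row {i} i<N = trans (cong length (row≡applyUpTo (<⇒≤ i<N))) (length-applyUpTo (mirrored ∘ (i +_)) N)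

  length-window : ∀ t → length (map not (reverse (Y t))) ≡ k
  length-window t = trans (length-map not (reverse (Y t))) (trans (length-reverse (Y t)) (length-Y t))

  key-row<N : ∀ {i} → i < N → key (row i) < N
  key-row<N {i} i<N = subst (λ n → key (row i) < 2 ^ n) (trans (cong length (window-row i<N)) (length-window (start i)))
                            (val<2^length (take k (row i)))

  last-row≡column : ∀ {i} → i < N → fromMaybe false (last (row i)) ≡ column N (key (row i))
  last-row≡column {i} i<N = begin
    fromMaybe false (last (row i))                     ≡⟨ cong (fromMaybe false) (last-row i<N) ⟩
    not (feedback (Y (start i)))                       ≡⟨ feedback-column (Y (start i)) (length-Y (start i)) ⟩
    column N (val (map not (reverse (Y (start i)))))   ≡⟨ cong (column N ∘ val) (window-row i<N) ⟨
    column N (key (row i))                             ∎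
    where open ≡-Reasoning

  start-shift : ∀ {i i'} → i ≤ i' → i' < N → start i' + (i' ∸ i) ≡ start i
  start-shift {i} {i'} i≤i' i'<N = sym (∸-≡ (begin
    start i' + (i' ∸ i) + (k + i)     ≡⟨ +-assoc (start i') (i' ∸ i) (k + i) ⟩
    start i' + (i' ∸ i + (k + i))     ≡⟨ cong (start i' +_) (+-assoc (i' ∸ i) k i) ⟨
    start i' + (i' ∸ i + k + i)       ≡⟨ cong (λ n → start i' + (n + i)) (+-comm (i' ∸ i) k) ⟩
    start i' + (k + (i' ∸ i) + i)     ≡⟨ cong (start i' +_) (+-assoc k (i' ∸ i) i) ⟩
    start i' + (k + (i' ∸ i + i))     ≡⟨ cong (λ n → start i' + (k + n)) (m∸n+n≡m i≤i') ⟩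
    start i' + (k + i')               ≡⟨ start+k+i i'<N ⟩
    N + N                             ∎))
    where open ≡-Reasoning

  -- Distinct rows have distinct windows, since the windows come from states less than N steps apart.
  row-keys-distinct : ∀ {i i'} → i < i' → i' < N → key (row i) ≢ key (row i')
  row-keys-distinct {i} {i'} i<i' i'<N same-key =
    Y-injective-mod (start i') (m<n⇒0<n∸m i<i') (≤-<-trans (m∸n≤m i' i) i'<N)
      (trans (sym same-state) (cong Y (sym (start-shift (<⇒≤ i<i') i'<N))))
    where
      same-window : map not (reverse (Y (start i))) ≡ map not (reverse (Y (start i')))
      same-window = val-injective (trans (length-window (start i)) (sym (length-window (start i'))))
        (trans (cong val (sym (window-row (<-trans i<i' i'<N)))) (trans same-key (cong val (window-row i'<N))))
      same-state : Y (start i) ≡ Y (start i')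
      same-state = reverse-injective (map-injective Boolₚ.not-injective same-window)

  private
    R : List (List Bool)
    R = rotations (M k)

  All-sorted-rows : ∀ {P : List Bool → Set} → (∀ {i} → i < N → P (row i)) → All P (sort R)
  All-sorted-rows Prow =
    All-resp-↭ (↭-sym (sort-↭ R)) (subst (All _) (sym rotations-M) (Allₚ.applyUpTo⁺₁ row N Prow))

  sorted-keys : map key (sort R) ≡ upTo N
  sorted-keys = increasing-range N
    (val-take-increasing k (sort-↗ R) distinct (All-sorted-rows (λ i<N → subst (k ≤_) (sym (length-row i<N)) (<⇒≤ k<N))))
    (universal (λ _ → z≤n) _)
    (Allₚ.map⁺ (All-sorted-rows key-row<N))
    (trans (length-map key (sort R)) (trans (↭-length (sort-↭ R)) (trans (cong length rotations-M) (length-applyUpTo row N))))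
    where
      distinct : AllPairs (λ r r' → key r ≢ key r') (sort R)
      distinct = Permₛ.AllPairs-resp-↭ (setoid (List Bool)) (λ ne → ne ∘ sym) (resp₂ _) (↭⇒↭ₛ (↭-sym (sort-↭ R)))
        (subst (AllPairs _) (sym rotations-M) (AllPairsₚ.applyUpTo⁺₁ row N row-keys-distinct))

  cBWT-M : cBWT (M k) ≡ map (column N) (upTo N)
  cBWT-M = begin
    map (λ r → fromMaybe false (last r)) (sort R)  ≡⟨ map-cong-local (All-sorted-rows last-row≡column) ⟩
    map (column N ∘ key) (sort R)                  ≡⟨ map-∘ (sort R) ⟩
    map (column N) (map key (sort R))              ≡⟨ cong (map (column N)) sorted-keys ⟩
    map (column N) (upTo N)                        ∎
    where open ≡-Reasoning

-- The claimed column is 1 (0011)^P 010 for n = 4 + 4P: odd j and odd ⌊ j /2⌋ depend only on j mod 4.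
column-pattern : ∀ P → applyUpTo (λ j → column (4 + P * 4) (suc j)) (3 + P * 4)
                       ≡ concat (replicate P (false ∷ false ∷ true ∷ true ∷ [])) ++ false ∷ true ∷ false ∷ []
column-pattern zero    = refl
column-pattern (suc P) = cong (λ w → false ∷ false ∷ true ∷ true ∷ w) (column-pattern P)

columns≡target : ∀ m → map (column (2 ^ suc (suc m))) (upTo (2 ^ suc (suc m))) ≡ target (suc (suc m))
columns≡target m = subst (λ n → map (column n) (upTo n) ≡ target (suc (suc m))) (sym 2^k≡4+P*4)
                         (trans (map-upTo (column (4 + P * 4)) (4 + P * 4)) (cong (true ∷_) (column-pattern P)))
  where
    P = 2 ^ m ∸ 1
    2^k≡4+P*4 : 2 ^ suc (suc m) ≡ 4 + P * 4
    2^k≡4+P*4 = trans (cong (λ n → 2 * (2 * n)) (sym (m+[n∸m]≡n (m^n>0 2 m)))) (expand P)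
      where
        expand : ∀ p → 2 * (2 * (1 + p)) ≡ 4 + p * 4
        expand = solve-∀

theorem2 : (k : ℕ) → 2 ≤ k → Primitive k (T k) → cBWT (M k) ≡ target k
theorem2 (suc zero)    (s≤s ()) _
theorem2 (suc (suc m)) _        T-primitive = trans (PrimitiveRegister.cBWT-M m T-primitive) (columns≡target m)
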